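{- For all integers $n,m\ge1$, $Z(P_n\boxtimes P_m)=Z_c(P_n\boxtimes P_m)\le n+m-1$.
   Context: All graphs are finite and simple. Color-change rule: if a black vertex $u$ has exactly one white neighbor $v$, then $v$ becomes black. A zero forcing set of $G$ is a set $Z\subseteq V(G)$ such that, starting with exactly $Z$ black, repeated application of the rule makes all vertices black; $Z(G)$ is the minimum size of a zero forcing set. A connected zero forcing set is a zero forcing set $S$ such that for every connected component $C$ of $G$, $S\cap V(C)$ induces a connected subgraph; $Z_c(G)$ is the minimum size of one. $P_n$ is the path on $n$ vertices. The strong product $G\boxtimes H$ has vertex set $V(G)\times V(H)$, with $(u,v)$ adjacent to $(u',v')$ iff ($u=u'$ and $vv'\in E(H)$) or ($v=v'$ and $uu'\in E(G)$) or ($uu'\in E(G)$ and $vv'\in E(H)$). -}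

module Defs where

open import Data.Nat using (ℕ; suc; _*_; _≤_)
open import Data.Fin using (Fin; toℕ; remQuot)
open import Data.Fin.Subset using (Subset; _∈_; ∣_∣)
open import Data.Product using (_×_; _,_; proj₁; proj₂; Σ)
open import Data.Sum using (_⊎_; inj₁; inj₂)
open import Data.Empty using (⊥)
open import Relation.Nullary using (¬_)
open import Relation.Binary.PropositionalEquality using (_≡_; refl; sym; trans; cong)
open import Data.Nat.Properties using (1+n≢n)

record Graph : Set₁ where
  field
    V     : ℕ
    Adj   : Fin V → Fin V → Set
    adj-sym : ∀ {x y} → Adj x y → Adj y x
    adj-irrefl : ∀ {x} → ¬ Adj x x
open Graph public

PathAdj : ∀ n → Fin n → Fin n → Set
PathAdj n i j = (suc (toℕ i) ≡ toℕ j) ⊎ (suc (toℕ j) ≡ toℕ i)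

P : ℕ → Graph
P n = record
  { V = n
  ; Adj = PathAdj n
  ; adj-sym = λ { (inj₁ e) → inj₂ e ; (inj₂ e) → inj₁ e }
  ; adj-irrefl = λ { {x} (inj₁ e) → 1+n≢n e ; {x} (inj₂ e) → 1+n≢n e }
  }

StrongAdj : (G H : Graph) → Fin (V G * V H) → Fin (V G * V H) → Set
StrongAdj G H x y =
  let u  = proj₁ (remQuot {V G} (V H) x) ; v  = proj₂ (remQuot {V G} (V H) x)
      u' = proj₁ (remQuot {V G} (V H) y) ; v' = proj₂ (remQuot {V G} (V H) y)
  in ((u ≡ u') × Adj H v v') ⊎ ((v ≡ v') × Adj G u u') ⊎ (Adj G u u' × Adj H v v')

_⊠_ : Graph → Graph → Graph
G ⊠ H = record
  { V = V G * V H
  ; Adj = StrongAdj G H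
  ; adj-sym = λ { (inj₁ (e , a)) → inj₁ (Relation.Binary.PropositionalEquality.sym e , adj-sym H a)
            ; (inj₂ (inj₁ (e , a))) → inj₂ (inj₁ (Relation.Binary.PropositionalEquality.sym e , adj-sym G a))
            ; (inj₂ (inj₂ (a , b))) → inj₂ (inj₂ (adj-sym G a , adj-sym H b)) }
  ; adj-irrefl = λ { (inj₁ (_ , a)) → adj-irrefl H a
               ; (inj₂ (inj₁ (_ , a))) → adj-irrefl G a
               ; (inj₂ (inj₂ (a , _))) → adj-irrefl G a }
  }

-- Vertices that end up black when starting from exactly Z black and applying
-- the color-change rule repeatedly: v becomes black if some black u is
-- adjacent to v and every neighbour of u other than v is already black
-- (i.e. v is the unique white neighbour of u).
data Black (G : Graph) (Z : Subset (V G)) : Fin (V G) → Set where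
  initial : ∀ {v} → v ∈ Z → Black G Z v
  force   : ∀ {u v} → Black G Z u → Adj G u v
          → (∀ w → Adj G u w → ¬ (w ≡ v) → Black G Z w)
          → Black G Z v

IsZeroForcingSet : (G : Graph) → Subset (V G) → Set
IsZeroForcingSet G Z = ∀ v → Black G Z v

data WalkIn (G : Graph) (S : Fin (V G) → Set) : Fin (V G) → Fin (V G) → Set where
  here : ∀ {x} → S x → WalkIn G S x x
  step : ∀ {x y z} → S x → Adj G x y → WalkIn G S y z → WalkIn G S x z

Reachable : (G : Graph) → Fin (V G) → Fin (V G) → Set
Reachable G = WalkIn G (λ _ → Fin (V G))

-- For every component C, S ∩ V(C) induces a connected subgraph:
-- any two vertices of S in the same component are joined by a walk inside S.
ComponentwiseConnected : (G : Graph) → Subset (V G) → Set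
ComponentwiseConnected G S =
  ∀ x y → x ∈ S → y ∈ S → Reachable G x y → WalkIn G (λ w → w ∈ S) x y

IsConnectedZeroForcingSet : (G : Graph) → Subset (V G) → Set
IsConnectedZeroForcingSet G S = IsZeroForcingSet G S × ComponentwiseConnected G S

IsMinimumSize : (G : Graph) → (Subset (V G) → Set) → ℕ → Set
IsMinimumSize G Q k =
  Σ (Subset (V G)) (λ S → Q S × ∣ S ∣ ≡ k) × (∀ S → Q S → k ≤ ∣ S ∣)

IsZeroForcingNumber : Graph → ℕ → Set
IsZeroForcingNumber G = IsMinimumSize G (IsZeroForcingSet G)

IsConnectedZeroForcingNumber : Graph → ℕ → Set
IsConnectedZeroForcingNumber G = IsMinimumSize G (IsConnectedZeroForcingSet G)

-- The first row and column (n + m − 1 vertices) form a connected set that forces the grid in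
-- order of r + c: the vertex (r, c) is forced by (r − 1, c − 1), all of whose other neighbours
-- come earlier. Conversely, when u forces v, a 2 × 2 block containing the edge uv is a clique
-- through u, so it turns completely black exactly at that step. Hence every force completes a
-- new one of the (n − 1)(m − 1) blocks, and a zero forcing set Z needs nm − ∣Z∣ ≤ (n − 1)(m − 1)
-- forces. When n or m is 1 the product is a path, forced from an end vertex.
module Submission where

open import Defs
open import Data.Bool using (Bool; true; false; _∨_)
open import Data.Empty using (⊥-elim)
open import Data.Fin as Fin using (Fin; zero; suc; toℕ; inject₁; combine; remQuot; _↑ˡ_; _↑ʳ_)
import Data.Fin.Properties as Finₚ
open import Data.Fin.Subset using (Subset; _∈_; _∉_; _⊆_; _⊂_; _∪_; ⁅_⁆; ∁; ⊤; ∣_∣)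
open import Data.Fin.Subset.Properties
  using (_∈?_; _⊆?_; x∈⁅x⁆; x∈⁅y⁆⇒x≡y; ∣⁅x⁆∣≡1; ∣⊤∣≡n; ∣⊥∣≡0; ∣p∣≤n; ⊆⊤; ⊆-refl; ⊆-trans; ⊆-antisym;
         p⊆q⇒∣p∣≤∣q∣; p⊂q⇒∣p∣<∣q∣; p⊆p∪q; x∈p∪q⁺; ∪-identityʳ; x∉p⇒x∈∁p; ∣∁p∣≡n∸∣p∣)
open import Data.Nat using (ℕ; zero; suc; pred; _+_; _*_; _∸_; _≤_; _<_; _≤?_; _≟_; z≤n; s≤s)
open import Data.Nat.Properties
open import Data.Product using (Σ; ∃₂; ∃-syntax; _×_; _,_; proj₁; proj₂)
open import Data.Sum using (_⊎_; inj₁; inj₂; [_,_]′)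
open import Data.Vec using (_∷_; tabulate; replicate)
open import Data.Vec.Properties using (lookup∘tabulate; tabulate-cong; []=⇒lookup; lookup⇒[]=)
open import Function using (_∘_)
open import Relation.Nullary using (Dec; yes; no; does; ¬?; _×-dec_; _⊎-dec_; contradiction)
open import Relation.Nullary.Decidable using (dec-true; decidable-stable)
open import Relation.Unary using (Pred; Decidable)
open import Relation.Binary.Definitions using (tri<; tri≈; tri>)
open import Relation.Binary.PropositionalEquality

subsetOf : ∀ {N p} {P : Pred (Fin N) p} → Decidable P → Subset N
subsetOf P? = tabulate (does ∘ P?)

module _ {N p} {P : Pred (Fin N) p} (P? : Decidable P) where

  ∈-subsetOf⁺ : ∀ {x} → P x → x ∈ subsetOf P?
  ∈-subsetOf⁺ {x} px = lookup⇒[]= x _ (trans (lookup∘tabulate (does ∘ P?) x) (dec-true (P? x) px))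

  ∈-subsetOf⁻ : ∀ {x} → x ∈ subsetOf P? → P x
  ∈-subsetOf⁻ {x} x∈ with P? x | trans (sym (lookup∘tabulate (does ∘ P?) x)) ([]=⇒lookup x∈)
  ... | yes px | _ = px

∣p∪⁅x⁆∣≤1+∣p∣ : ∀ {N} (p : Subset N) x → ∣ p ∪ ⁅ x ⁆ ∣ ≤ suc ∣ p ∣
∣p∪⁅x⁆∣≤1+∣p∣ (true ∷ p)  zero    rewrite ∪-identityʳ p = n≤1+n _
∣p∪⁅x⁆∣≤1+∣p∣ (false ∷ p) zero    rewrite ∪-identityʳ p = ≤-refl
∣p∪⁅x⁆∣≤1+∣p∣ (true ∷ p)  (suc x) = s≤s (∣p∪⁅x⁆∣≤1+∣p∣ p x)
∣p∪⁅x⁆∣≤1+∣p∣ (false ∷ p) (suc x) = ∣p∪⁅x⁆∣≤1+∣p∣ p x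

module _ {G : Graph} {S : Fin (V G) → Set} where

  walk-snoc : ∀ {x y z} → WalkIn G S x y → Adj G y z → S z → WalkIn G S x z
  walk-snoc (here sx)        y~z sz = step sx y~z (here sz)
  walk-snoc (step sx x~x′ w) y~z sz = step sx x~x′ (walk-snoc w y~z sz)

  walk-reverse : ∀ {x y} → WalkIn G S x y → WalkIn G S y x
  walk-reverse (here sx)        = here sx
  walk-reverse (step sx x~x′ w) = walk-snoc (walk-reverse w) (adj-sym G x~x′) sx

  _++ʷ_ : ∀ {x y z} → WalkIn G S x y → WalkIn G S y z → WalkIn G S x z
  here _        ++ʷ w′ = w′
  step sx x~x′ w ++ʷ w′ = step sx x~x′ (w ++ʷ w′)

  walk-alongPath : ∀ {k} (f : Fin (suc k) → Fin (V G)) → (∀ i → S (f i)) →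
    (∀ i → Adj G (f (suc i)) (f (inject₁ i))) → ∀ i → WalkIn G S (f i) (f zero)
  walk-alongPath f s f~ zero = here (s zero)
  walk-alongPath {suc k} f s f~ (suc i) =
    step (s (suc i)) (f~ i) (walk-alongPath (f ∘ inject₁) (s ∘ inject₁) (f~ ∘ inject₁) i)

module _ (G : Graph) where

  componentwiseConnected-viaHub : ∀ {S} (h : Fin (V G)) →
    (∀ {x} → x ∈ S → WalkIn G (_∈ S) x h) → ComponentwiseConnected G S
  componentwiseConnected-viaHub h toHub x y x∈S y∈S _ = toHub x∈S ++ʷ walk-reverse (toHub y∈S)

  singleton-componentwiseConnected : ∀ z → ComponentwiseConnected G ⁅ z ⁆
  singleton-componentwiseConnected z = componentwiseConnected-viaHub z λ {x} x∈⁅z⁆ →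
    subst (λ y → WalkIn G (_∈ ⁅ z ⁆) y z) (sym (x∈⁅y⁆⇒x≡y z x∈⁅z⁆)) (here (x∈⁅x⁆ z))

  zeroForcingNumbers-bounded : ∀ W → IsConnectedZeroForcingSet G W →
    (∀ Z → IsZeroForcingSet G Z → ∣ W ∣ ≤ ∣ Z ∣) → ∀ {bound} → ∣ W ∣ ≤ bound →
    Σ ℕ λ k → IsZeroForcingNumber G k × IsConnectedZeroForcingNumber G k × k ≤ bound
  zeroForcingNumbers-bounded W (zf , conn) minimal ∣W∣≤bound =
    ∣ W ∣ , ((W , zf , refl) , minimal) , ((W , (zf , conn) , refl) , λ Z → minimal Z ∘ proj₁) ,
    ∣W∣≤bound

  black⇒seeded : ∀ {Z v} → Black G Z v → ∃[ x ] x ∈ Z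
  black⇒seeded (initial x∈Z)   = _ , x∈Z
  black⇒seeded (force black-u _ _) = black⇒seeded black-u

  isZeroForcingSet⇒nonempty : ∀ {Z} → IsZeroForcingSet G Z → Fin (V G) → 1 ≤ ∣ Z ∣
  isZeroForcingSet⇒nonempty {Z} zf v with black⇒seeded (zf v)
  ... | x , x∈Z = subst (_≤ ∣ Z ∣) (∣⁅x⁆∣≡1 x)
    (p⊆q⇒∣p∣≤∣q∣ λ y∈⁅x⁆ → subst (_∈ Z) (sym (x∈⁅y⁆⇒x≡y x y∈⁅x⁆)) x∈Z)

  ForcedInOrder : (Fin (V G) → ℕ) → Subset (V G) → Fin (V G) → Set
  ForcedInOrder rank Z x = x ∈ Z ⊎ ∃[ u ] (Adj G u x × rank u < rank x ×
                                            (∀ w → Adj G u w → w ≢ x → rank w < rank x))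

  isZeroForcingSet-inOrder : ∀ rank Z → (∀ x → ForcedInOrder rank Z x) → IsZeroForcingSet G Z
  isZeroForcingSet-inOrder rank Z forced x = black (suc (rank x)) x ≤-refl
    where
    black : ∀ t x → rank x < t → Black G Z x
    black (suc t) x (s≤s x≤t) with forced x
    ... | inj₁ x∈Z = initial x∈Z
    ... | inj₂ (u , u~x , u<x , w<x) =
      force (black t u (≤-trans u<x x≤t)) u~x λ w u~w w≢x → black t w (≤-trans (w<x w u~w w≢x) x≤t)

  ForcingStep : Subset (V G) → Fin (V G) → Fin (V G) → Set
  ForcingStep B u v = u ∈ B × Adj G u v × v ∉ B × (∀ w → Adj G u w → w ≢ v → w ∈ B)

  module _ (adj? : ∀ x y → Dec (Adj G x y)) where

    black∉⇒forcingStep : ∀ {Z B x} → Z ⊆ B → Black G Z x → x ∉ B → ∃₂ (ForcingStep B)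
    black∉⇒forcingStep Z⊆B (initial x∈Z) x∉B = ⊥-elim (x∉B (Z⊆B x∈Z))
    black∉⇒forcingStep {B = B} Z⊆B (force {u} {v} black-u u~v black-w) v∉B with u ∈? B
    ... | no u∉B = black∉⇒forcingStep Z⊆B black-u u∉B
    ... | yes u∈B with Finₚ.any? (λ w → adj? u w ×-dec ¬? (w Finₚ.≟ v) ×-dec ¬? (w ∈? B))
    ...   | yes (w , u~w , w≢v , w∉B) = black∉⇒forcingStep Z⊆B (black-w w u~w w≢v) w∉B
    ...   | no none = u , v , u∈B , u~v , v∉B ,
            λ w u~w w≢v → decidable-stable (w ∈? B) λ w∉B → none (w , u~w , w≢v , w∉B)

    -- Each force blackens one vertex and raises Φ by at least one, so ∣ B ∣ ≤ ∣ Z ∣ + Φ B is invariant.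
    zeroForcing-potentialBound : (Φ : Subset (V G) → ℕ) →
      (∀ {B u v} → ForcingStep B u v → Φ B < Φ (B ∪ ⁅ v ⁆)) →
      ∀ Z → IsZeroForcingSet G Z → V G ≤ ∣ Z ∣ + Φ ⊤
    zeroForcing-potentialBound Φ grows Z zf = go (V G) Z (m≤n+m (V G) ∣ Z ∣) ⊆-refl (m≤m+n ∣ Z ∣ (Φ Z))
      where
      go : ∀ t B → V G ≤ ∣ B ∣ + t → Z ⊆ B → ∣ B ∣ ≤ ∣ Z ∣ + Φ B → V G ≤ ∣ Z ∣ + Φ ⊤
      go t B fuel Z⊆B bound with Finₚ.any? (λ x → ¬? (x ∈? B))
      ... | no noWhite = subst (λ C → V G ≤ ∣ Z ∣ + Φ C) B≡⊤ (subst (_≤ ∣ Z ∣ + Φ B) ∣B∣≡V bound)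
        where
        B≡⊤ : B ≡ ⊤
        B≡⊤ = ⊆-antisym ⊆⊤ λ {x} _ → decidable-stable (x ∈? B) λ x∉B → noWhite (x , x∉B)
        ∣B∣≡V : ∣ B ∣ ≡ V G
        ∣B∣≡V = trans (cong ∣_∣ B≡⊤) (∣⊤∣≡n (V G))
      ... | yes (x , x∉B) with black∉⇒forcingStep Z⊆B (zf x) x∉B
      ...   | u , v , forcing@(_ , _ , v∉B , _) = continue t fuel
        where
        B′ : Subset (V G)
        B′ = B ∪ ⁅ v ⁆
        ∣B∣<∣B′∣ : ∣ B ∣ < ∣ B′ ∣
        ∣B∣<∣B′∣ = p⊂q⇒∣p∣<∣q∣ (p⊆p∪q ⁅ v ⁆ , v , x∈p∪q⁺ (inj₂ (x∈⁅x⁆ v)) , v∉B)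
        bound′ : ∣ B′ ∣ ≤ ∣ Z ∣ + Φ B′
        bound′ = begin
          ∣ B′ ∣              ≤⟨ ∣p∪⁅x⁆∣≤1+∣p∣ B v ⟩
          suc ∣ B ∣           ≤⟨ s≤s bound ⟩
          suc (∣ Z ∣ + Φ B)   ≡⟨ +-suc ∣ Z ∣ (Φ B) ⟨
          ∣ Z ∣ + suc (Φ B)   ≤⟨ +-monoʳ-≤ ∣ Z ∣ (grows forcing) ⟩
          ∣ Z ∣ + Φ B′        ∎
          where open ≤-Reasoning
        continue : ∀ t → V G ≤ ∣ B ∣ + t → V G ≤ ∣ Z ∣ + Φ ⊤
        continue zero    fuel = contradiction
          (≤-trans (∣p∣≤n B′) (subst (V G ≤_) (+-identityʳ ∣ B ∣) fuel)) (<⇒≱ ∣B∣<∣B′∣)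
        continue (suc t) fuel = go t B′
          (≤-trans fuel (subst (_≤ ∣ B′ ∣ + t) (sym (+-suc ∣ B ∣ t)) (+-monoˡ-≤ t ∣B∣<∣B′∣)))
          (⊆-trans Z⊆B (p⊆p∪q ⁅ v ⁆)) bound′

Near : ℕ → ℕ → Set
Near r s = r ≡ s ⊎ suc r ≡ s ⊎ suc s ≡ r

Window : ℕ → ℕ → Set
Window R r = r ≤ R × R ≤ suc r

window? : ∀ R r → Dec (Window R r)
window? R r = (r ≤? R) ×-dec (R ≤? suc r)

near⇒≤suc : ∀ {r s} → Near r s → s ≤ suc r
near⇒≤suc (inj₁ refl)        = n≤1+n _
near⇒≤suc (inj₂ (inj₁ refl)) = ≤-refl
near⇒≤suc (inj₂ (inj₂ refl)) = ≤-trans (n≤1+n _) (n≤1+n _)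

window⇒near : ∀ {R r s} → Window R r → Window R s → Near r s
window⇒near {r = r} {s} (r≤R , R≤1+r) (s≤R , R≤1+s) with <-cmp r s
... | tri< r<s _ _ = inj₂ (inj₁ (≤-antisym r<s (≤-trans s≤R R≤1+r)))
... | tri≈ _ r≡s _ = inj₁ r≡s
... | tri> _ _ s<r = inj₂ (inj₂ (≤-antisym s<r (≤-trans r≤R R≤1+s)))

near⇒window : ∀ {k r s} → 2 ≤ k → r < k → s < k → Near r s →
  ∃[ R ] 1 ≤ R × R < k × Window R r × Window R s
near⇒window {r = zero}  2≤k _ _ (inj₁ refl) = 1 , ≤-refl , 2≤k , (z≤n , ≤-refl) , (z≤n , ≤-refl)
near⇒window {r = suc r} _ r<k _ (inj₁ refl) = suc r , s≤s z≤n , r<k , (≤-refl , n≤1+n _) , (≤-refl , n≤1+n _)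
near⇒window _ _ s<k (inj₂ (inj₁ refl)) = _ , s≤s z≤n , s<k , (n≤1+n _ , ≤-refl) , (≤-refl , n≤1+n _)
near⇒window _ r<k _ (inj₂ (inj₂ refl)) = _ , s≤s z≤n , r<k , (≤-refl , n≤1+n _) , (n≤1+n _ , ≤-refl)

tabulate-const : ∀ {A : Set} k (x : A) → tabulate {n = k} (λ _ → x) ≡ replicate k x
tabulate-const zero    x = refl
tabulate-const (suc k) x = cong (x ∷_) (tabulate-const k x)

∣tabulate-++∣ : ∀ p {q} (f : Fin (p + q) → Bool) →
  ∣ tabulate f ∣ ≡ ∣ tabulate (f ∘ (_↑ˡ q)) ∣ + ∣ tabulate (f ∘ (p ↑ʳ_)) ∣
∣tabulate-++∣ zero    f = refl
∣tabulate-++∣ (suc p) f with f zero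
... | true  = cong suc (∣tabulate-++∣ p (f ∘ suc))
... | false = ∣tabulate-++∣ p (f ∘ suc)

gridSubset : ∀ {k m} → (Fin k → Fin m → Bool) → Subset (k * m)
gridSubset {k} {m} g = tabulate λ x → g (proj₁ (remQuot {k} m x)) (proj₂ (remQuot {k} m x))

remQuot-↑ʳ : ∀ {k} m (y : Fin (k * m)) →
  remQuot {suc k} m (m ↑ʳ y) ≡ (suc (proj₁ (remQuot {k} m y)) , proj₂ (remQuot {k} m y))
remQuot-↑ʳ {k} m y rewrite Finₚ.splitAt-↑ʳ m (k * m) y = refl

∣gridSubset∣-suc : ∀ {k m} (g : Fin (suc k) → Fin m → Bool) →
  ∣ gridSubset g ∣ ≡ ∣ tabulate (g zero) ∣ + ∣ gridSubset (g ∘ suc) ∣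
∣gridSubset∣-suc {k} {m} g = trans (∣tabulate-++∣ m _) (cong₂ _+_
  (cong ∣_∣ (tabulate-cong λ j → cong (λ (i , j) → g i j) (Finₚ.remQuot-combine zero j)))
  (cong ∣_∣ (tabulate-cong λ y → cong (λ (i , j) → g i j) (remQuot-↑ʳ m y))))

∣gridSubset∣-rowIndependent : ∀ k {m} (h : Fin m → Bool) →
  ∣ gridSubset {k} (λ _ → h) ∣ ≡ k * ∣ tabulate h ∣
∣gridSubset∣-rowIndependent zero    h = refl
∣gridSubset∣-rowIndependent (suc k) h =
  trans (∣gridSubset∣-suc (λ _ → h)) (cong (∣ tabulate h ∣ +_) (∣gridSubset∣-rowIndependent k h))

pathAdj? : ∀ k (i j : Fin k) → Dec (PathAdj k i j)
pathAdj? k i j = (suc (toℕ i) ≟ toℕ j) ⊎-dec (suc (toℕ j) ≟ toℕ i)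

toℕ-pred : ∀ {k} (i : Fin k) → toℕ (Fin.pred i) ≡ pred (toℕ i)
toℕ-pred zero    = refl
toℕ-pred (suc i) = Finₚ.toℕ-inject₁ i

≢zero⇒1≤toℕ : ∀ {k} {i : Fin (suc k)} → i ≢ zero → 1 ≤ toℕ i
≢zero⇒1≤toℕ {i = zero}  i≢0 = contradiction refl i≢0
≢zero⇒1≤toℕ {i = suc i} _   = s≤s z≤n

≤suc-pred : ∀ {r s} k → s < suc k → s ≤ suc (pred r) → 1 ≤ r ⊎ k ≡ 0 → s ≤ r
≤suc-pred k _          s≤ (inj₁ (s≤s z≤n)) = s≤
≤suc-pred _ (s≤s z≤n) _  (inj₂ refl)       = z≤n

module Grid (a b : ℕ) where

  n m : ℕ
  n = suc a
  m = suc b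

  G : Graph
  G = P n ⊠ P m

  row : Fin (n * m) → Fin n
  row x = proj₁ (remQuot {n} m x)

  col : Fin (n * m) → Fin m
  col x = proj₂ (remQuot {n} m x)

  rowℕ colℕ : Fin (n * m) → ℕ
  rowℕ x = toℕ (row x)
  colℕ x = toℕ (col x)

  vertex : Fin n → Fin m → Fin (n * m)
  vertex = combine

  corner : Fin (n * m)
  corner = vertex zero zero

  row-vertex : ∀ i j → row (vertex i j) ≡ i
  row-vertex i j = cong proj₁ (Finₚ.remQuot-combine i j)

  col-vertex : ∀ i j → col (vertex i j) ≡ j
  col-vertex i j = cong proj₂ (Finₚ.remQuot-combine i j)

  vertex-row-col : ∀ x → vertex (row x) (col x) ≡ x
  vertex-row-col = Finₚ.combine-remQuot {n} m

  coords-injective : ∀ {x y} → rowℕ x ≡ rowℕ y → colℕ x ≡ colℕ y → x ≡ y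
  coords-injective {x} {y} r≡ c≡ = begin
    x                         ≡⟨ vertex-row-col x ⟨
    vertex (row x) (col x)    ≡⟨ cong₂ vertex (Finₚ.toℕ-injective r≡) (Finₚ.toℕ-injective c≡) ⟩
    vertex (row y) (col y)    ≡⟨ vertex-row-col y ⟩
    y                         ∎
    where open ≡-Reasoning

  adj? : ∀ x y → Dec (Adj G x y)
  adj? x y = ((row x Finₚ.≟ row y) ×-dec pathAdj? m (col x) (col y))
       ⊎-dec ((col x Finₚ.≟ col y) ×-dec pathAdj? n (row x) (row y))
       ⊎-dec (pathAdj? n (row x) (row y) ×-dec pathAdj? m (col x) (col y))

  adj⇒near : ∀ {x y} → Adj G x y → Near (rowℕ x) (rowℕ y) × Near (colℕ x) (colℕ y)
  adj⇒near (inj₁ (r≡ , c~))        = inj₁ (cong toℕ r≡) , inj₂ c~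
  adj⇒near (inj₂ (inj₁ (c≡ , r~))) = inj₂ r~ , inj₁ (cong toℕ c≡)
  adj⇒near (inj₂ (inj₂ (r~ , c~))) = inj₂ r~ , inj₂ c~

  near⇒adj : ∀ {x y} → Near (rowℕ x) (rowℕ y) → Near (colℕ x) (colℕ y) → x ≢ y → Adj G x y
  near⇒adj (inj₁ r≡) (inj₁ c≡) x≢y = contradiction (coords-injective r≡ c≡) x≢y
  near⇒adj (inj₁ r≡) (inj₂ c~) _   = inj₁ (Finₚ.toℕ-injective r≡ , c~)
  near⇒adj (inj₂ r~) (inj₁ c≡) _   = inj₂ (inj₁ (Finₚ.toℕ-injective c≡ , r~))
  near⇒adj (inj₂ r~) (inj₂ c~) _   = inj₂ (inj₂ (r~ , c~))

  vertex-adj : ∀ {i i′ j j′} → Near (toℕ i) (toℕ i′) → Near (toℕ j) (toℕ j′) → (i , j) ≢ (i′ , j′) →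
    Adj G (vertex i j) (vertex i′ j′)
  vertex-adj {i} {i′} {j} {j′} i~i′ j~j′ ij≢i′j′ = near⇒adj {vertex i j} {vertex i′ j′}
    (subst₂ Near (cong toℕ (sym (row-vertex i j))) (cong toℕ (sym (row-vertex i′ j′))) i~i′)
    (subst₂ Near (cong toℕ (sym (col-vertex i j))) (cong toℕ (sym (col-vertex i′ j′))) j~j′)
    λ eq → ij≢i′j′ (trans (sym (Finₚ.remQuot-combine i j))
                           (trans (cong (remQuot m) eq) (Finₚ.remQuot-combine i′ j′)))

  vertex-adjʳ : ∀ i {j j′} → PathAdj m j j′ → Adj G (vertex i j) (vertex i j′)
  vertex-adjʳ i {j} {j′} j~j′ = vertex-adj {i} {i} {j} {j′} (inj₁ refl) (inj₂ j~j′)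
    λ eq → adj-irrefl (P m) (subst (PathAdj m j) (sym (cong proj₂ eq)) j~j′)

  vertex-adjᶜ : ∀ {i i′} j → PathAdj n i i′ → Adj G (vertex i j) (vertex i′ j)
  vertex-adjᶜ {i} {i′} j i~i′ = vertex-adj {i} {i′} {j} {j} (inj₂ i~i′) (inj₁ refl)
    λ eq → adj-irrefl (P n) (subst (PathAdj n i) (sym (cong proj₁ eq)) i~i′)

  rank : Fin (n * m) → ℕ
  rank x = rowℕ x + colℕ x

  rank-dominated : ∀ {w x} → rowℕ w ≤ rowℕ x → colℕ w ≤ colℕ x → w ≢ x → rank w < rank x
  rank-dominated r≤ c≤ w≢x with m≤n⇒m<n∨m≡n r≤ | m≤n⇒m<n∨m≡n c≤
  ... | inj₁ r< | _       = +-mono-<-≤ r< c≤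
  ... | inj₂ _  | inj₁ c< = +-mono-≤-< r≤ c<
  ... | inj₂ r≡ | inj₂ c≡ = contradiction (coords-injective r≡ c≡) w≢x

  diagonal : Fin (n * m) → Fin (n * m)
  diagonal x = vertex (Fin.pred (row x)) (Fin.pred (col x))

  rowℕ-diagonal : ∀ x → rowℕ (diagonal x) ≡ pred (rowℕ x)
  rowℕ-diagonal x = trans (cong toℕ (row-vertex (Fin.pred (row x)) (Fin.pred (col x)))) (toℕ-pred (row x))

  colℕ-diagonal : ∀ x → colℕ (diagonal x) ≡ pred (colℕ x)
  colℕ-diagonal x = trans (cong toℕ (col-vertex (Fin.pred (row x)) (Fin.pred (col x)))) (toℕ-pred (col x))

  -- For x = (r, c), diagonal x = (r ∸ 1, c ∸ 1); its neighbours stay inside [0, r] × [0, c],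
  -- except across a zero coordinate, where this needs the corresponding path to be P₁.
  diagonal-forces : ∀ Z x → 1 ≤ rowℕ x ⊎ a ≡ 0 → 1 ≤ colℕ x ⊎ b ≡ 0 → 1 ≤ rowℕ x ⊎ 1 ≤ colℕ x →
    ForcedInOrder G rank Z x
  diagonal-forces Z x room-r room-c off-corner =
    inj₂ (u , near⇒adj (near-pred (rowℕ-diagonal x)) (near-pred (colℕ-diagonal x)) u≢x ,
          rank-dominated u-row≤ u-col≤ u≢x ,
          λ w u~w → rank-dominated (row≤ w u~w) (col≤ w u~w))
    where
    u : Fin (n * m)
    u = diagonal x
    near-pred : ∀ {s r} → s ≡ pred r → Near s r
    near-pred {r = zero}  refl = inj₁ refl
    near-pred {r = suc r} refl = inj₂ (inj₁ refl)
    u-row≤ : rowℕ u ≤ rowℕ x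
    u-row≤ = subst (_≤ rowℕ x) (sym (rowℕ-diagonal x)) pred[n]≤n
    u-col≤ : colℕ u ≤ colℕ x
    u-col≤ = subst (_≤ colℕ x) (sym (colℕ-diagonal x)) pred[n]≤n
    pred≢ : ∀ {r} → 1 ≤ r → pred r ≢ r
    pred≢ (s≤s z≤n) eq = 1+n≢n (sym eq)
    u≢x : u ≢ x
    u≢x u≡x = [ (λ 1≤r → pred≢ 1≤r (trans (sym (rowℕ-diagonal x)) (cong rowℕ u≡x)))
              , (λ 1≤c → pred≢ 1≤c (trans (sym (colℕ-diagonal x)) (cong colℕ u≡x))) ]′ off-corner
    row≤ : ∀ w → Adj G u w → rowℕ w ≤ rowℕ x
    row≤ w u~w = ≤suc-pred a (Finₚ.toℕ<n (row w))
      (subst (λ s → rowℕ w ≤ suc s) (rowℕ-diagonal x) (near⇒≤suc (proj₁ (adj⇒near {u} {w} u~w)))) room-r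
    col≤ : ∀ w → Adj G u w → colℕ w ≤ colℕ x
    col≤ w u~w = ≤suc-pred b (Finₚ.toℕ<n (col w))
      (subst (λ s → colℕ w ≤ suc s) (colℕ-diagonal x) (near⇒≤suc (proj₂ (adj⇒near {u} {w} u~w)))) room-c

  off-corner : ∀ {x} → x ≢ corner → 1 ≤ rowℕ x ⊎ 1 ≤ colℕ x
  off-corner {x} x≢corner with rowℕ x in r≡ | colℕ x in c≡
  ... | suc _ | _     = inj₁ (s≤s z≤n)
  ... | zero  | suc _ = inj₂ (s≤s z≤n)
  ... | zero  | zero  = contradiction
    (coords-injective (trans r≡ (cong toℕ (sym (row-vertex zero zero))))
                      (trans c≡ (cong toℕ (sym (col-vertex zero zero))))) x≢corner

  thin-room : a ≡ 0 ⊎ b ≡ 0 → ∀ {x} → 1 ≤ rowℕ x ⊎ 1 ≤ colℕ x →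
    (1 ≤ rowℕ x ⊎ a ≡ 0) × (1 ≤ colℕ x ⊎ b ≡ 0)
  thin-room (inj₁ a≡0) {x} = λ where
    (inj₁ 1≤r) → contradiction (subst (λ k → rowℕ x < suc k) a≡0 (Finₚ.toℕ<n (row x))) (≤⇒≯ 1≤r)
    (inj₂ 1≤c) → inj₂ a≡0 , inj₁ 1≤c
  thin-room (inj₂ b≡0) {x} = λ where
    (inj₁ 1≤r) → inj₁ 1≤r , inj₂ b≡0
    (inj₂ 1≤c) → contradiction (subst (λ k → colℕ x < suc k) b≡0 (Finₚ.toℕ<n (col x))) (≤⇒≯ 1≤c)

  corner-isZeroForcingSet : a ≡ 0 ⊎ b ≡ 0 → IsZeroForcingSet G ⁅ corner ⁆
  corner-isZeroForcingSet thin = isZeroForcingSet-inOrder G rank ⁅ corner ⁆ forced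
    where
    forced : ∀ x → ForcedInOrder G rank ⁅ corner ⁆ x
    forced x with x ∈? ⁅ corner ⁆
    ... | yes x∈ = inj₁ x∈
    ... | no x∉ = let off = off-corner {x} λ x≡corner →
                              x∉ (subst (_∈ ⁅ corner ⁆) (sym x≡corner) (x∈⁅x⁆ corner))
                      (room-r , room-c) = thin-room thin {x} off
                  in diagonal-forces ⁅ corner ⁆ x room-r room-c off

  Interior : Fin (n * m) → Set
  Interior q = 1 ≤ rowℕ q × 1 ≤ colℕ q

  interior? : Decidable Interior
  interior? q = (1 ≤? rowℕ q) ×-dec (1 ≤? colℕ q)

  OnAxis : Fin (n * m) → Set
  OnAxis x = row x ≡ zero ⊎ col x ≡ zero

  onAxis? : Decidable OnAxis
  onAxis? x = (row x Finₚ.≟ zero) ⊎-dec (col x Finₚ.≟ zero)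

  Axes : Subset (n * m)
  Axes = subsetOf onAxis?

  ∉Axes⇒interior : ∀ {x} → x ∉ Axes → Interior x
  ∉Axes⇒interior x∉ =
    ≢zero⇒1≤toℕ (x∉ ∘ ∈-subsetOf⁺ onAxis? ∘ inj₁) , ≢zero⇒1≤toℕ (x∉ ∘ ∈-subsetOf⁺ onAxis? ∘ inj₂)

  interior⇒∉Axes : ∀ {q} → Interior q → q ∉ Axes
  interior⇒∉Axes (1≤r , 1≤c) q∈ with ∈-subsetOf⁻ onAxis? q∈
  ... | inj₁ r≡0 = contradiction (subst (λ i → 1 ≤ toℕ i) r≡0 1≤r) λ ()
  ... | inj₂ c≡0 = contradiction (subst (λ j → 1 ≤ toℕ j) c≡0 1≤c) λ ()

  Axes-isZeroForcingSet : IsZeroForcingSet G Axes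
  Axes-isZeroForcingSet = isZeroForcingSet-inOrder G rank Axes forced
    where
    forced : ∀ x → ForcedInOrder G rank Axes x
    forced x with x ∈? Axes
    ... | yes x∈ = inj₁ x∈
    ... | no x∉ = let (1≤r , 1≤c) = ∉Axes⇒interior {x} x∉
                  in diagonal-forces Axes x (inj₁ 1≤r) (inj₁ 1≤c) (inj₁ 1≤r)

  Axes-componentwiseConnected : ComponentwiseConnected G Axes
  Axes-componentwiseConnected = componentwiseConnected-viaHub G corner toCorner
    where
    step-down : ∀ {k} (i : Fin k) → PathAdj (suc k) (suc i) (inject₁ i)
    step-down i = inj₂ (cong suc (Finₚ.toℕ-inject₁ i))
    toCorner : ∀ {x} → x ∈ Axes → WalkIn G (_∈ Axes) x corner
    toCorner {x} x∈ with ∈-subsetOf⁻ onAxis? x∈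
    ... | inj₁ r≡0 = subst (λ y → WalkIn G (_∈ Axes) y corner)
      (trans (cong (λ i → vertex i (col x)) (sym r≡0)) (vertex-row-col x))
      (walk-alongPath (vertex zero) (λ j → ∈-subsetOf⁺ onAxis? (inj₁ (row-vertex zero j)))
                      (λ j → vertex-adjʳ zero (step-down j)) (col x))
    ... | inj₂ c≡0 = subst (λ y → WalkIn G (_∈ Axes) y corner)
      (trans (cong (vertex (row x)) (sym c≡0)) (vertex-row-col x))
      (walk-alongPath (λ i → vertex i zero) (λ i → ∈-subsetOf⁺ onAxis? (inj₂ (col-vertex i zero)))
                      (λ i → vertex-adjᶜ zero (step-down i)) (row x))

  ∣Axes∣ : ∣ Axes ∣ ≡ m + a
  ∣Axes∣ = begin
    ∣ Axes ∣
      ≡⟨ ∣gridSubset∣-suc {a} {m} (λ i j → does (i Finₚ.≟ zero) ∨ does (j Finₚ.≟ zero)) ⟩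
    ∣ tabulate {n = m} (λ _ → true) ∣ + ∣ gridSubset {a} (λ _ j → does (j Finₚ.≟ zero)) ∣
      ≡⟨ cong₂ _+_ (trans (cong ∣_∣ (tabulate-const m true)) (∣⊤∣≡n m))
                   (∣gridSubset∣-rowIndependent a (λ j → does (j Finₚ.≟ zero))) ⟩
    m + a * ∣ tabulate {n = m} (λ j → does (j Finₚ.≟ zero)) ∣
      ≡⟨ cong (λ k → m + a * suc k) (trans (cong ∣_∣ (tabulate-const b false)) (∣⊥∣≡0 b)) ⟩
    m + a * 1
      ≡⟨ cong (m +_) (*-identityʳ a) ⟩
    m + a ∎
    where open ≡-Reasoning

  -- Square q is the 2 × 2 block whose largest vertex is q.
  InSquare : Fin (n * m) → Fin (n * m) → Set
  InSquare q y = Window (rowℕ q) (rowℕ y) × Window (colℕ q) (colℕ y)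

  inSquare? : ∀ q → Decidable (InSquare q)
  inSquare? q y = window? (rowℕ q) (rowℕ y) ×-dec window? (colℕ q) (colℕ y)

  Square : Fin (n * m) → Subset (n * m)
  Square q = subsetOf (inSquare? q)

  square-clique : ∀ {q y z} → y ∈ Square q → z ∈ Square q → y ≢ z → Adj G y z
  square-clique {q} {y} {z} y∈ z∈ =
    let (ry , cy) = ∈-subsetOf⁻ (inSquare? q) y∈
        (rz , cz) = ∈-subsetOf⁻ (inSquare? q) z∈
    in near⇒adj {y} {z} (window⇒near ry rz) (window⇒near cy cz)

  vertex-at : ∀ {R C} → R < n → C < m → ∃[ q ] rowℕ q ≡ R × colℕ q ≡ C
  vertex-at R<n C<m = vertex (Fin.fromℕ< R<n) (Fin.fromℕ< C<m)
    , trans (cong toℕ (row-vertex _ (Fin.fromℕ< C<m))) (Finₚ.toℕ-fromℕ< R<n)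
    , trans (cong toℕ (col-vertex (Fin.fromℕ< R<n) _)) (Finₚ.toℕ-fromℕ< C<m)

  edge-inSquare : 1 ≤ a → 1 ≤ b → ∀ {u v} → Adj G u v → ∃[ q ] Interior q × u ∈ Square q × v ∈ Square q
  edge-inSquare 1≤a 1≤b {u} {v} u~v
    with near⇒window (s≤s 1≤a) (Finₚ.toℕ<n (row u)) (Finₚ.toℕ<n (row v)) (proj₁ (adj⇒near {u} {v} u~v))
       | near⇒window (s≤s 1≤b) (Finₚ.toℕ<n (col u)) (Finₚ.toℕ<n (col v)) (proj₂ (adj⇒near {u} {v} u~v))
  ... | R , 1≤R , R<n , ru , rv | C , 1≤C , C<m , cu , cv with vertex-at R<n C<m
  ...   | q , refl , refl =
    q , (1≤R , 1≤C) , ∈-subsetOf⁺ (inSquare? q) (ru , cu) , ∈-subsetOf⁺ (inSquare? q) (rv , cv)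

  full? : ∀ B → Decidable (λ q → Interior q × Square q ⊆ B)
  full? B q = interior? q ×-dec (Square q ⊆? B)

  FullSquares : Subset (n * m) → Subset (n * m)
  FullSquares B = subsetOf (full? B)

  -- The square through the forcing edge u → v becomes full: v is its only vertex outside B,
  -- since the square is a clique containing u.
  forcingStep-completesSquare : 1 ≤ a → 1 ≤ b → ∀ {B u v} → ForcingStep G B u v →
    FullSquares B ⊂ FullSquares (B ∪ ⁅ v ⁆)
  forcingStep-completesSquare 1≤a 1≤b {B} {u} {v} (u∈B , u~v , v∉B , others)
    with edge-inSquare 1≤a 1≤b {u} {v} u~v
  ... | q , interior , u∈sq , v∈sq =
    grow , q , ∈-subsetOf⁺ (full? B′) (interior , sq⊆B′) ,
    λ q∈ → v∉B (proj₂ (∈-subsetOf⁻ (full? B) q∈) v∈sq)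
    where
    B′ : Subset (n * m)
    B′ = B ∪ ⁅ v ⁆
    grow : FullSquares B ⊆ FullSquares B′
    grow q∈ = let (int , sq⊆B) = ∈-subsetOf⁻ (full? B) q∈
              in ∈-subsetOf⁺ (full? B′) (int , p⊆p∪q ⁅ v ⁆ ∘ sq⊆B)
    sq⊆B′ : Square q ⊆ B′
    sq⊆B′ {y} y∈sq with y Finₚ.≟ v | y Finₚ.≟ u
    ... | yes refl | _        = x∈p∪q⁺ (inj₂ (x∈⁅x⁆ v))
    ... | no _     | yes refl = p⊆p∪q ⁅ v ⁆ u∈B
    ... | no y≢v   | no y≢u   =
      p⊆p∪q ⁅ v ⁆ (others y (square-clique {q} {u} {y} u∈sq y∈sq (y≢u ∘ sym)) y≢v)

  Axes-minimum : 1 ≤ a → 1 ≤ b → ∀ Z → IsZeroForcingSet G Z → ∣ Axes ∣ ≤ ∣ Z ∣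
  Axes-minimum 1≤a 1≤b Z zf = begin
    ∣ Axes ∣                       ≡⟨ m∸[m∸n]≡n (∣p∣≤n Axes) ⟨
    n * m ∸ (n * m ∸ ∣ Axes ∣)     ≡⟨ cong (n * m ∸_) (∣∁p∣≡n∸∣p∣ Axes) ⟨
    n * m ∸ ∣ ∁ Axes ∣             ≤⟨ m≤n+o⇒m∸n≤o (n * m) ∣ ∁ Axes ∣ (subst (n * m ≤_) (+-comm ∣ Z ∣ _) bound) ⟩
    ∣ Z ∣                          ∎
    where
    open ≤-Reasoning
    full⊆∁Axes : FullSquares ⊤ ⊆ ∁ Axes
    full⊆∁Axes q∈ = x∉p⇒x∈∁p (interior⇒∉Axes (proj₁ (∈-subsetOf⁻ (full? ⊤) q∈)))
    bound : n * m ≤ ∣ Z ∣ + ∣ ∁ Axes ∣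
    bound = ≤-trans (zeroForcing-potentialBound G adj? (∣_∣ ∘ FullSquares)
                      (p⊂q⇒∣p∣<∣q∣ ∘ forcingStep-completesSquare 1≤a 1≤b) Z zf)
                    (+-monoʳ-≤ ∣ Z ∣ (p⊆q⇒∣p∣≤∣q∣ full⊆∁Axes))

  corner-numbers : a ≡ 0 ⊎ b ≡ 0 → Σ ℕ λ k →
    IsZeroForcingNumber G k × IsConnectedZeroForcingNumber G k × k ≤ n + m ∸ 1
  corner-numbers thin = zeroForcingNumbers-bounded G ⁅ corner ⁆
    (corner-isZeroForcingSet thin , singleton-componentwiseConnected G corner)
    (λ Z zf → subst (_≤ ∣ Z ∣) (sym (∣⁅x⁆∣≡1 corner)) (isZeroForcingSet⇒nonempty G zf corner))
    (subst (_≤ a + m) (sym (∣⁅x⁆∣≡1 corner)) (≤-trans (s≤s z≤n) (m≤n+m m a)))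

  Axes-numbers : 1 ≤ a → 1 ≤ b → Σ ℕ λ k →
    IsZeroForcingNumber G k × IsConnectedZeroForcingNumber G k × k ≤ n + m ∸ 1
  Axes-numbers 1≤a 1≤b = zeroForcingNumbers-bounded G Axes
    (Axes-isZeroForcingSet , Axes-componentwiseConnected)
    (Axes-minimum 1≤a 1≤b)
    (≤-reflexive (trans ∣Axes∣ (+-comm m a)))

mainTheorem4 : (n m : ℕ) → 1 ≤ n → 1 ≤ m →
    Σ ℕ (λ k → IsZeroForcingNumber (P n ⊠ P m) k
             × IsConnectedZeroForcingNumber (P n ⊠ P m) k
             × k ≤ n + m ∸ 1)
mainTheorem4 (suc zero)    (suc b)       _ _ = Grid.corner-numbers 0 b (inj₁ refl)
mainTheorem4 (suc (suc a)) (suc zero)    _ _ = Grid.corner-numbers (suc a) 0 (inj₂ refl)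
mainTheorem4 (suc (suc a)) (suc (suc b)) _ _ = Grid.Axes-numbers (suc a) (suc b) (s≤s z≤n) (s≤s z≤n)
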